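{- On closed terms of $\lambda_S$, the relations $\cong$, $\cong_F$ and $\approx$ coincide: $\cong\;=\;\cong_F\;=\;\approx$.
   Context: The calculus $\lambda_S$: terms $t ::= v \mid t\,t \mid \mathcal{S}k.t \mid \langle t\rangle$, values $v ::= x \mid \lambda x.t$. Pure contexts $E ::= \square \mid v\,E \mid E\,t$; evaluation contexts $F ::= \square \mid v\,F \mid F\,t \mid \langle F\rangle$; contexts $C ::= \square \mid \lambda x.C \mid t\,C \mid C\,t \mid \mathcal{S}k.C \mid \langle C\rangle$. Reduction: $F[(\lambda x.t)\,v] \to F[t\{v/x\}]$; $F[\langle E[\mathcal{S}k.t]\rangle] \to F[\langle t\{\lambda x.\langle E[x]\rangle/k\}\rangle]$ ($x\notin\mathrm{fv}(E)$); $F[\langle v\rangle]\to F[v]$. Normal form: value or non-value that does not reduce; control-stuck term: $E[\mathcal{S}k.t]$; $t\Downarrow t'$: $t\to^* t'$ with $t'$ a normal form. For closed terms: $t_0\cong t_1$ iff for every closed context $C$, $C[t_0]$ evaluates to a value iff $C[t_1]$ does, and $C[t_0]$ evaluates to a control-stuck term iff $C[t_1]$ does; $t_0\cong_F t_1$ iff the same two conditions hold for every closed evaluation context $F$ in place of $C$. Applicative bisimilarity $\approx$: labeled transition system on closed terms with labels $\tau$, closed values $v$, closed pure contexts $E$: $(\lambda x.t)\,v \xrightarrow{\tau} t\{v/x\}$; if $t_0\xrightarrow{\tau}t_0'$ then $t_0\,t_1\xrightarrow{\tau}t_0'\,t_1$; if $t\xrightarrow{\tau}t'$ then $v\,t\xrightarrow{\tau}v\,t'$;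 $\langle v\rangle\xrightarrow{\tau}v$; if $t\xrightarrow{\tau}t'$ then $\langle t\rangle\xrightarrow{\tau}\langle t'\rangle$; if $t\xrightarrow{\square}t'$ then $\langle t\rangle\xrightarrow{\tau}t'$; $\lambda x.t\xrightarrow{v}t\{v/x\}$; $\mathcal{S}k.t\xrightarrow{E}\langle t\{\lambda x.\langle E[x]\rangle/k\}\rangle$ ($x\notin\mathrm{fv}(E)$); if $t_0\xrightarrow{E[\square\,t_1]}t_0'$ then $t_0\,t_1\xrightarrow{E}t_0'$; if $t\xrightarrow{E[v\,\square]}t'$ then $v\,t\xrightarrow{E}t'$. $\overset{\tau}{\Rightarrow}$ is the reflexive-transitive closure of $\xrightarrow{\tau}$; for $\alpha\ne\tau$, $\overset{\alpha}{\Rightarrow}=\overset{\tau}{\Rightarrow}\xrightarrow{\alpha}$. $R$ is an applicative simulation if $t_0\,R\,t_1$ and $t_0\xrightarrow{\alpha}t_0'$ imply $t_1\overset{\alpha}{\Rightarrow}t_1'$ with $t_0'\,R\,t_1'$ for some $t_1'$; an applicative bisimulation if $R$ and $R^{ -1}$ are simulations; $\approx$ is the largest applicative bisimulation. -}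

module Defs where

open import Data.Nat using (ℕ; zero; suc)
open import Data.Fin using (Fin; zero; suc)
open import Data.Sum using (_⊎_)
open import Data.Product using (Σ; ∃; ∃-syntax; _×_; _,_)
open import Relation.Nullary using (¬_)
open import Relation.Binary.PropositionalEquality using (_≡_)
open import Relation.Binary.Construct.Closure.ReflexiveTransitive using (Star)
open import Function.Bundles using (_⇔_)

-- Syntax of λ_S (well-scoped de Bruijn terms; Tm n = terms with at most
-- n free variables, Tm 0 = closed terms).
--   var x | λx.t | t t | Sk.t (sft, binds k) | ⟨t⟩ (rst)

data Tm (n : ℕ) : Set where
  var : Fin n → Tm n
  lam : Tm (suc n) → Tm n
  app : Tm n → Tm n → Tm n
  sft : Tm (suc n) → Tm n
  rst : Tm n → Tm n

data Value {n : ℕ} : Tm n → Set where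
  vvar : (x : Fin n) → Value (var x)
  vlam : (t : Tm (suc n)) → Value (lam t)

Ren : ℕ → ℕ → Set
Ren n m = Fin n → Fin m

extR : ∀ {n m} → Ren n m → Ren (suc n) (suc m)
extR ρ zero    = zero
extR ρ (suc i) = suc (ρ i)

ren : ∀ {n m} → Ren n m → Tm n → Tm m
ren ρ (var x)   = var (ρ x)
ren ρ (lam t)   = lam (ren (extR ρ) t)
ren ρ (app t u) = app (ren ρ t) (ren ρ u)
ren ρ (sft t)   = sft (ren (extR ρ) t)
ren ρ (rst t)   = rst (ren ρ t)

renValue : ∀ {n m} (ρ : Ren n m) {v : Tm n} → Value v → Value (ren ρ v)
renValue ρ (vvar x) = vvar (ρ x)
renValue ρ (vlam t) = vlam (ren (extR ρ) t)

Sub : ℕ → ℕ → Set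
Sub n m = Fin n → Tm m

extS : ∀ {n m} → Sub n m → Sub (suc n) (suc m)
extS σ zero    = var zero
extS σ (suc i) = ren suc (σ i)

sub : ∀ {n m} → Sub n m → Tm n → Tm m
sub σ (var x)   = σ x
sub σ (lam t)   = lam (sub (extS σ) t)
sub σ (app t u) = app (sub σ t) (sub σ u)
sub σ (sft t)   = sft (sub (extS σ) t)
sub σ (rst t)   = rst (sub σ t)

sub0 : ∀ {n} → Tm (suc n) → Tm n → Tm n
sub0 {n} t u = sub σ t
  where
  σ : Sub (suc n) n
  σ zero    = u
  σ (suc i) = var i

data PCtx (n : ℕ) : Set where
  hole : PCtx n
  vapp : (v : Tm n) → Value v → PCtx n → PCtx n
  appl : PCtx n → Tm n → PCtx n

plugE : ∀ {n} → PCtx n → Tm n → Tm n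
plugE hole         t = t
plugE (vapp v _ E) t = app v (plugE E t)
plugE (appl E u)   t = app (plugE E t) u

renE : ∀ {n m} → Ren n m → PCtx n → PCtx m
renE ρ hole         = hole
renE ρ (vapp v p E) = vapp (ren ρ v) (renValue ρ p) (renE ρ E)
renE ρ (appl E u)   = appl (renE ρ E) (ren ρ u)

compE : ∀ {n} → PCtx n → PCtx n → PCtx n
compE hole         E' = E'
compE (vapp v p E) E' = vapp v p (compE E E')
compE (appl E u)   E' = appl (compE E E') u

-- the captured continuation λx.⟨E[x]⟩ (x fresh: E is weakened)
cont : ∀ {n} → PCtx n → Tm n
cont E = lam (rst (plugE (renE suc E) (var zero)))

data ECtx (n : ℕ) : Set where
  hole : ECtx n
  vapp : (v : Tm n) → Value v → ECtx n → ECtx n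
  appl : ECtx n → Tm n → ECtx n
  rst  : ECtx n → ECtx n

plugF : ∀ {n} → ECtx n → Tm n → Tm n
plugF hole         t = t
plugF (vapp v _ F) t = app v (plugF F t)
plugF (appl F u)   t = app (plugF F t) u
plugF (rst F)      t = rst (plugF F t)

-- The hole may sit under binders; since only closed terms
-- are plugged in, plugging weakens the closed term (no capture).

data Ctx (n : ℕ) : Set where
  hole : Ctx n
  lam  : Ctx (suc n) → Ctx n
  appr : Tm n → Ctx n → Ctx n
  appl : Ctx n → Tm n → Ctx n
  sft  : Ctx (suc n) → Ctx n
  rst  : Ctx n → Ctx n

plugC : ∀ {n} → Ctx n → Tm 0 → Tm n
plugC hole       t = ren (λ ()) t
plugC (lam C)    t = lam (plugC C t)
plugC (appr u C) t = app u (plugC C t)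
plugC (appl C u) t = app (plugC C t) u
plugC (sft C)    t = sft (plugC C t)
plugC (rst C)    t = rst (plugC C t)

infix 4 _⟶_
data _⟶_ {n : ℕ} : Tm n → Tm n → Set where
  β-red   : (F : ECtx n) {t : Tm (suc n)} {v : Tm n} → Value v →
            plugF F (app (lam t) v) ⟶ plugF F (sub0 t v)
  sft-red : (F : ECtx n) (E : PCtx n) (t : Tm (suc n)) →
            plugF F (rst (plugE E (sft t))) ⟶ plugF F (rst (sub0 t (cont E)))
  rst-red : (F : ECtx n) {v : Tm n} → Value v →
            plugF F (rst v) ⟶ plugF F v

_⟶*_ : ∀ {n} → Tm n → Tm n → Set
_⟶*_ = Star _⟶_

NormalForm : ∀ {n} → Tm n → Set
NormalForm t = Value t ⊎ (¬ Value t × (∀ t' → ¬ (t ⟶ t')))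

ControlStuck : ∀ {n} → Tm n → Set
ControlStuck {n} t = ∃[ E ] ∃[ s ] (t ≡ plugE {n} E (sft s))

_⇓_ : ∀ {n} → Tm n → Tm n → Set
t ⇓ t' = (t ⟶* t') × NormalForm t'

EvalsToValue : Tm 0 → Set
EvalsToValue t = ∃[ t' ] ((t ⇓ t') × Value t')

EvalsToStuck : Tm 0 → Set
EvalsToStuck t = ∃[ t' ] ((t ⇓ t') × ControlStuck t')

_≅_ : Tm 0 → Tm 0 → Set
t₀ ≅ t₁ = (C : Ctx 0) →
  (EvalsToValue (plugC C t₀) ⇔ EvalsToValue (plugC C t₁)) ×
  (EvalsToStuck (plugC C t₀) ⇔ EvalsToStuck (plugC C t₁))

_≅F_ : Tm 0 → Tm 0 → Set
t₀ ≅F t₁ = (F : ECtx 0) →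
  (EvalsToValue (plugF F t₀) ⇔ EvalsToValue (plugF F t₁)) ×
  (EvalsToStuck (plugF F t₀) ⇔ EvalsToStuck (plugF F t₁))

data Label : Set where
  τ   : Label
  val : (v : Tm 0) → Value v → Label
  ctx : PCtx 0 → Label

data Step : Label → Tm 0 → Tm 0 → Set where
  β      : ∀ {t v} → Value v → Step τ (app (lam t) v) (sub0 t v)
  appL-τ : ∀ {t₀ t₀' t₁} → Step τ t₀ t₀' → Step τ (app t₀ t₁) (app t₀' t₁)
  appR-τ : ∀ {v t t'} → Value v → Step τ t t' → Step τ (app v t) (app v t')
  rst-v  : ∀ {v} → Value v → Step τ (rst v) v
  rst-τ  : ∀ {t t'} → Step τ t t' → Step τ (rst t) (rst t')
  rst-□  : ∀ {t t'} → Step (ctx hole) t t' → Step τ (rst t) t'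
  lam-v  : ∀ {t v} (p : Value v) → Step (val v p) (lam t) (sub0 t v)
  sft-E  : ∀ {t} (E : PCtx 0) → Step (ctx E) (sft t) (rst (sub0 t (cont E)))
  appL-E : ∀ {E t₀ t₀' t₁} →
           Step (ctx (compE E (appl hole t₁))) t₀ t₀' →
           Step (ctx E) (app t₀ t₁) t₀'
  appR-E : ∀ {E v t t'} (p : Value v) →
           Step (ctx (compE E (vapp v p hole))) t t' →
           Step (ctx E) (app v t) t'

WeakStep : Label → Tm 0 → Tm 0 → Set
WeakStep τ t t' = Star (Step τ) t t'
WeakStep α@(val _ _) t t'' = ∃[ t' ] (Star (Step τ) t t' × Step α t' t'')
WeakStep α@(ctx _)   t t'' = ∃[ t' ] (Star (Step τ) t t' × Step α t' t'')

Rel₀ : Set₁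
Rel₀ = Tm 0 → Tm 0 → Set

IsSimulation : Rel₀ → Set
IsSimulation R = ∀ {t₀ t₁} → R t₀ t₁ → ∀ α t₀' → Step α t₀ t₀' →
  ∃[ t₁' ] (WeakStep α t₁ t₁' × R t₀' t₁')

IsBisimulation : Rel₀ → Set
IsBisimulation R = IsSimulation R × IsSimulation (λ t₁ t₀ → R t₀ t₁)

-- applicative bisimilarity: the largest applicative bisimulation,
-- i.e. the union of all applicative bisimulations
_≈_ : Tm 0 → Tm 0 → Set₁
t₀ ≈ t₁ = Σ Rel₀ λ R → IsBisimulation R × R t₀ t₁

-- Howe's method. Applicative similarity ≲ is a preorder and a simulation. Its
-- Howe closure ≲ᴴ contains it, is compatible with every term former and with
-- value substitution, and is itself a simulation: simulating a β-step or a
-- capture of the context by Sk.t only ever substitutes ≲ᴴ-related values into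
-- ≲ᴴ-related bodies. Simulations preserve both observations (reaching a value,
-- getting control-stuck), so bisimilar terms are contextually equivalent.
-- Conversely ≅F is itself an applicative bisimulation, because every label is
-- implemented by an evaluation context: a value label v by □ v, a context
-- label E by ⟨E⟩, and τ-steps are exactly reduction steps. Finally ≅ ⇒ ≅F
-- since evaluation contexts are contexts.

module Submission where

open import Defs
open import Data.Nat using (suc)
open import Data.Fin using (Fin; zero; suc)
open import Data.Sum using (_⊎_; inj₁; inj₂)
open import Data.Product using (Σ; ∃-syntax; _×_; _,_; proj₁; proj₂)
open import Data.Empty using (⊥-elim)
open import Level using (0ℓ)
open import Relation.Nullary using (¬_)
open import Relation.Binary.Bundles using (Setoid)
open import Relation.Binary.Structures using (IsEquivalence)
open import Relation.Binary.PropositionalEquality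
  using (_≡_; _≢_; refl; sym; trans; cong; cong₂; subst; subst₂)
open import Relation.Binary.Construct.Closure.ReflexiveTransitive
  using (Star; ε; _◅_; _◅◅_)
open import Function.Bundles using (_⇔_; mk⇔; Equivalence)
open import Function.Properties.Equivalence using (⇔-isEquivalence)
import Relation.Binary.Reasoning.Setoid as SetoidReasoning

-- Substitution

extR-extR : ∀ {n m k} {ρ : Ren n m} {ρ' : Ren m k} {ρ'' : Ren n k} →
  (∀ i → ρ' (ρ i) ≡ ρ'' i) → ∀ i → extR ρ' (extR ρ i) ≡ extR ρ'' i
extR-extR h zero    = refl
extR-extR h (suc i) = cong suc (h i)

ren-ren : ∀ {n m k} {ρ : Ren n m} {ρ' : Ren m k} {ρ'' : Ren n k} →
  (∀ i → ρ' (ρ i) ≡ ρ'' i) → ∀ t → ren ρ' (ren ρ t) ≡ ren ρ'' t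
ren-ren h (var x)   = cong var (h x)
ren-ren h (lam t)   = cong lam (ren-ren (extR-extR h) t)
ren-ren h (app t u) = cong₂ app (ren-ren h t) (ren-ren h u)
ren-ren h (sft t)   = cong sft (ren-ren (extR-extR h) t)
ren-ren h (rst t)   = cong rst (ren-ren h t)

extR-id : ∀ {n} {ρ : Ren n n} → (∀ i → ρ i ≡ i) → ∀ i → extR ρ i ≡ i
extR-id h zero    = refl
extR-id h (suc i) = cong suc (h i)

ren-id : ∀ {n} {ρ : Ren n n} → (∀ i → ρ i ≡ i) → ∀ t → ren ρ t ≡ t
ren-id h (var x)   = cong var (h x)
ren-id h (lam t)   = cong lam (ren-id (extR-id h) t)
ren-id h (app t u) = cong₂ app (ren-id h t) (ren-id h u)
ren-id h (sft t)   = cong sft (ren-id (extR-id h) t)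
ren-id h (rst t)   = cong rst (ren-id h t)

extS-extR : ∀ {n m k} {ρ : Ren n m} {σ : Sub m k} {σ' : Sub n k} →
  (∀ i → σ (ρ i) ≡ σ' i) → ∀ i → extS σ (extR ρ i) ≡ extS σ' i
extS-extR h zero    = refl
extS-extR h (suc i) = cong (ren suc) (h i)

sub-ren : ∀ {n m k} {ρ : Ren n m} {σ : Sub m k} {σ' : Sub n k} →
  (∀ i → σ (ρ i) ≡ σ' i) → ∀ t → sub σ (ren ρ t) ≡ sub σ' t
sub-ren h (var x)   = h x
sub-ren h (lam t)   = cong lam (sub-ren (extS-extR h) t)
sub-ren h (app t u) = cong₂ app (sub-ren h t) (sub-ren h u)
sub-ren h (sft t)   = cong sft (sub-ren (extS-extR h) t)
sub-ren h (rst t)   = cong rst (sub-ren h t)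

extR-extS : ∀ {n m k} {σ : Sub n m} {ρ : Ren m k} {σ' : Sub n k} →
  (∀ i → ren ρ (σ i) ≡ σ' i) → ∀ i → ren (extR ρ) (extS σ i) ≡ extS σ' i
extR-extS h zero              = refl
extR-extS {σ = σ} h (suc i) =
  trans (ren-ren (λ _ → refl) (σ i))
        (trans (sym (ren-ren (λ _ → refl) (σ i))) (cong (ren suc) (h i)))

ren-sub : ∀ {n m k} {σ : Sub n m} {ρ : Ren m k} {σ' : Sub n k} →
  (∀ i → ren ρ (σ i) ≡ σ' i) → ∀ t → ren ρ (sub σ t) ≡ sub σ' t
ren-sub h (var x)   = h x
ren-sub h (lam t)   = cong lam (ren-sub (extR-extS h) t)
ren-sub h (app t u) = cong₂ app (ren-sub h t) (ren-sub h u)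
ren-sub h (sft t)   = cong sft (ren-sub (extR-extS h) t)
ren-sub h (rst t)   = cong rst (ren-sub h t)

extS-extS : ∀ {n m k} {σ : Sub n m} {σ₂ : Sub m k} {σ' : Sub n k} →
  (∀ i → sub σ₂ (σ i) ≡ σ' i) → ∀ i → sub (extS σ₂) (extS σ i) ≡ extS σ' i
extS-extS h zero              = refl
extS-extS {σ = σ} h (suc i) =
  trans (sub-ren (λ _ → refl) (σ i))
        (trans (sym (ren-sub (λ _ → refl) (σ i))) (cong (ren suc) (h i)))

sub-sub : ∀ {n m k} {σ : Sub n m} {σ₂ : Sub m k} {σ' : Sub n k} →
  (∀ i → sub σ₂ (σ i) ≡ σ' i) → ∀ t → sub σ₂ (sub σ t) ≡ sub σ' t
sub-sub h (var x)   = h x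
sub-sub h (lam t)   = cong lam (sub-sub (extS-extS h) t)
sub-sub h (app t u) = cong₂ app (sub-sub h t) (sub-sub h u)
sub-sub h (sft t)   = cong sft (sub-sub (extS-extS h) t)
sub-sub h (rst t)   = cong rst (sub-sub h t)

var-extR : ∀ {n m} {ρ : Ren n m} {σ : Sub n m} →
  (∀ i → var (ρ i) ≡ σ i) → ∀ i → var (extR ρ i) ≡ extS σ i
var-extR h zero    = refl
var-extR h (suc i) = cong (ren suc) (h i)

ren-as-sub : ∀ {n m} {ρ : Ren n m} {σ : Sub n m} →
  (∀ i → var (ρ i) ≡ σ i) → ∀ t → ren ρ t ≡ sub σ t
ren-as-sub h (var x)   = h x
ren-as-sub h (lam t)   = cong lam (ren-as-sub (var-extR h) t)
ren-as-sub h (app t u) = cong₂ app (ren-as-sub h t) (ren-as-sub h u)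
ren-as-sub h (sft t)   = cong sft (ren-as-sub (var-extR h) t)
ren-as-sub h (rst t)   = cong rst (ren-as-sub h t)

sub-id : ∀ {n} {σ : Sub n n} → (∀ i → σ i ≡ var i) → ∀ t → sub σ t ≡ t
sub-id h t = trans (sym (ren-as-sub (λ i → sym (h i)) t)) (ren-id (λ _ → refl) t)

sub-cong : ∀ {n m} {σ σ' : Sub n m} → (∀ i → σ i ≡ σ' i) → ∀ t → sub σ t ≡ sub σ' t
sub-cong {σ = σ} h t = trans (cong (sub σ) (sym (ren-id (λ _ → refl) t))) (sub-ren h t)

sub-closed : (σ : Sub 0 0) (t : Tm 0) → sub σ t ≡ t
sub-closed σ = sub-id (λ ())

ren-closed : (ρ : Ren 0 0) (t : Tm 0) → ren ρ t ≡ t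
ren-closed ρ = ren-id (λ ())

single : ∀ {n} → Tm n → Sub (suc n) n
single u zero    = u
single u (suc i) = var i

sub0-single : ∀ {n} (t : Tm (suc n)) u → sub0 t u ≡ sub (single u) t
sub0-single t u = sub-cong (λ { zero → refl ; (suc i) → refl }) t

ValueSub : ∀ {n m} → Sub n m → Set
ValueSub σ = ∀ i → Value (σ i)

sub-value : ∀ {n m} {σ : Sub n m} → ValueSub σ → ∀ {v} → Value v → Value (sub σ v)
sub-value vσ (vvar x) = vσ x
sub-value vσ (vlam t) = vlam _

extS-value : ∀ {n m} {σ : Sub n m} → ValueSub σ → ValueSub (extS σ)
extS-value vσ zero    = vvar zero
extS-value vσ (suc i) = renValue suc (vσ i)

single-value : ∀ {n} {v : Tm n} → Value v → ValueSub (single v)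
single-value pv zero    = pv
single-value pv (suc i) = vvar i

closed-value-lam : ∀ {v : Tm 0} → Value v → ∃[ s ] (v ≡ lam s)
closed-value-lam (vlam t) = t , refl

value-irrelevant : ∀ {n} {v : Tm n} (p q : Value v) → p ≡ q
value-irrelevant (vvar x) (vvar .x) = refl
value-irrelevant (vlam t) (vlam .t) = refl

-- Contexts

compE-identityʳ : ∀ {n} (E : PCtx n) → compE E hole ≡ E
compE-identityʳ hole         = refl
compE-identityʳ (vapp v p E) = cong (vapp v p) (compE-identityʳ E)
compE-identityʳ (appl E u)   = cong (λ X → appl X u) (compE-identityʳ E)

compE-assoc : ∀ {n} (E₁ E₂ E₃ : PCtx n) →
  compE (compE E₁ E₂) E₃ ≡ compE E₁ (compE E₂ E₃)
compE-assoc hole          E₂ E₃ = refl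
compE-assoc (vapp v p E₁) E₂ E₃ = cong (vapp v p) (compE-assoc E₁ E₂ E₃)
compE-assoc (appl E₁ u)   E₂ E₃ = cong (λ X → appl X u) (compE-assoc E₁ E₂ E₃)

plugE-compE : ∀ {n} (E E' : PCtx n) t → plugE (compE E E') t ≡ plugE E (plugE E' t)
plugE-compE hole         E' t = refl
plugE-compE (vapp v p E) E' t = cong (app v) (plugE-compE E E' t)
plugE-compE (appl E u)   E' t = cong (λ X → app X u) (plugE-compE E E' t)

compF : ∀ {n} → ECtx n → ECtx n → ECtx n
compF hole         G = G
compF (vapp v p F) G = vapp v p (compF F G)
compF (appl F u)   G = appl (compF F G) u
compF (rst F)      G = rst (compF F G)

plugF-compF : ∀ {n} (F G : ECtx n) t → plugF (compF F G) t ≡ plugF F (plugF G t)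
plugF-compF hole         G t = refl
plugF-compF (vapp v p F) G t = cong (app v) (plugF-compF F G t)
plugF-compF (appl F u)   G t = cong (λ X → app X u) (plugF-compF F G t)
plugF-compF (rst F)      G t = cong rst (plugF-compF F G t)

pureToECtx : ∀ {n} → PCtx n → ECtx n
pureToECtx hole         = hole
pureToECtx (vapp v p E) = vapp v p (pureToECtx E)
pureToECtx (appl E u)   = appl (pureToECtx E) u

plugF-pureToECtx : ∀ {n} (E : PCtx n) t → plugF (pureToECtx E) t ≡ plugE E t
plugF-pureToECtx hole         t = refl
plugF-pureToECtx (vapp v p E) t = cong (app v) (plugF-pureToECtx E t)
plugF-pureToECtx (appl E u)   t = cong (λ X → app X u) (plugF-pureToECtx E t)

toCtx : ECtx 0 → Ctx 0
toCtx hole         = hole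
toCtx (vapp v p F) = appr v (toCtx F)
toCtx (appl F u)   = appl (toCtx F) u
toCtx (rst F)      = rst (toCtx F)

plugC-toCtx : ∀ F t → plugC (toCtx F) t ≡ plugF F t
plugC-toCtx hole         t = ren-closed _ t
plugC-toCtx (vapp v p F) t = cong (app v) (plugC-toCtx F t)
plugC-toCtx (appl F u)   t = cong (λ X → app X u) (plugC-toCtx F t)
plugC-toCtx (rst F)      t = cong rst (plugC-toCtx F t)

-- Reduction and τ-steps

plugF-⟶ : ∀ {n} (G : ECtx n) {t t' : Tm n} → t ⟶ t' → plugF G t ⟶ plugF G t'
plugF-⟶ G (β-red F p) =
  subst₂ _⟶_ (plugF-compF G F _) (plugF-compF G F _) (β-red (compF G F) p)
plugF-⟶ G (sft-red F E t) =
  subst₂ _⟶_ (plugF-compF G F _) (plugF-compF G F _) (sft-red (compF G F) E t)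
plugF-⟶ G (rst-red F p) =
  subst₂ _⟶_ (plugF-compF G F _) (plugF-compF G F _) (rst-red (compF G F) p)

plugF-⟶* : ∀ {n} (G : ECtx n) {t t' : Tm n} → t ⟶* t' → plugF G t ⟶* plugF G t'
plugF-⟶* G ε       = ε
plugF-⟶* G (r ◅ q) = plugF-⟶ G r ◅ plugF-⟶* G q

_⇒τ_ : Tm 0 → Tm 0 → Set
_⇒τ_ = Star (Step τ)

value-no-τ : ∀ {v t} → Value v → ¬ Step τ v t
value-no-τ (vlam t) ()

value-no-ctx : ∀ {v t E} → Value v → ¬ Step (ctx E) v t
value-no-ctx (vlam t) ()

ctx-τ-exclusive : ∀ {t a b E} → Step (ctx E) t a → ¬ Step τ t b
ctx-τ-exclusive (appL-E s) (β _)          = value-no-ctx (vlam _) s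
ctx-τ-exclusive (appL-E s) (appL-τ s')    = ctx-τ-exclusive s s'
ctx-τ-exclusive (appL-E s) (appR-τ p _)   = value-no-ctx p s
ctx-τ-exclusive (appR-E p s) (β q)        = value-no-ctx q s
ctx-τ-exclusive (appR-E p s) (appL-τ s')  = value-no-τ p s'
ctx-τ-exclusive (appR-E p s) (appR-τ _ s') = ctx-τ-exclusive s s'

visible-no-τ : ∀ {α a b c} → α ≢ τ → Step α a b → ¬ Step τ a c
visible-no-τ {τ}       α≢τ _ = ⊥-elim (α≢τ refl)
visible-no-τ {val _ _} _ (lam-v _) = value-no-τ (vlam _)
visible-no-τ {ctx _}   _ s = ctx-τ-exclusive s

ctx-deterministic : ∀ {t a b E} → Step (ctx E) t a → Step (ctx E) t b → a ≡ b
ctx-deterministic (sft-E E)    (sft-E .E)    = refl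
ctx-deterministic (appL-E s)   (appL-E s')   = ctx-deterministic s s'
ctx-deterministic (appL-E s)   (appR-E p _)  = ⊥-elim (value-no-ctx p s)
ctx-deterministic (appR-E p _) (appL-E s')   = ⊥-elim (value-no-ctx p s')
ctx-deterministic (appR-E p s) (appR-E q s') with value-irrelevant p q
... | refl = ctx-deterministic s s'

τ-deterministic : ∀ {t a b} → Step τ t a → Step τ t b → a ≡ b
τ-deterministic (β _)        (β _)         = refl
τ-deterministic (β p)        (appR-τ _ s') = ⊥-elim (value-no-τ p s')
τ-deterministic (appL-τ s)   (appL-τ s')   = cong (λ X → app X _) (τ-deterministic s s')
τ-deterministic (appL-τ s)   (appR-τ p _)  = ⊥-elim (value-no-τ p s)
τ-deterministic (appR-τ _ s) (β p)         = ⊥-elim (value-no-τ p s)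
τ-deterministic (appR-τ p _) (appL-τ s')   = ⊥-elim (value-no-τ p s')
τ-deterministic (appR-τ _ s) (appR-τ _ s') = cong (app _) (τ-deterministic s s')
τ-deterministic (rst-v _)    (rst-v _)     = refl
τ-deterministic (rst-v p)    (rst-τ s')    = ⊥-elim (value-no-τ p s')
τ-deterministic (rst-v p)    (rst-□ s')    = ⊥-elim (value-no-ctx p s')
τ-deterministic (rst-τ s)    (rst-v p)     = ⊥-elim (value-no-τ p s)
τ-deterministic (rst-τ s)    (rst-τ s')    = cong rst (τ-deterministic s s')
τ-deterministic (rst-τ s)    (rst-□ s')    = ⊥-elim (ctx-τ-exclusive s' s)
τ-deterministic (rst-□ s)    (rst-v p)     = ⊥-elim (value-no-ctx p s)
τ-deterministic (rst-□ s)    (rst-τ s')    = ⊥-elim (ctx-τ-exclusive s s')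
τ-deterministic (rst-□ s)    (rst-□ s')    = ctx-deterministic s s'

⇒τ-comparable : ∀ {c x y} → c ⇒τ x → c ⇒τ y → (x ⇒τ y) ⊎ (y ⇒τ x)
⇒τ-comparable ε       q        = inj₁ q
⇒τ-comparable (s ◅ q) ε        = inj₂ (s ◅ q)
⇒τ-comparable (s ◅ q) (s' ◅ q') with τ-deterministic s s'
... | refl = ⇒τ-comparable q q'

stuck-ctx-step : ∀ (E₀ E : PCtx 0) s →
  Step (ctx E₀) (plugE E (sft s)) (rst (sub0 s (cont (compE E₀ E))))
stuck-ctx-step E₀ hole s =
  subst (λ X → Step (ctx E₀) (sft s) (rst (sub0 s (cont X))))
        (sym (compE-identityʳ E₀)) (sft-E E₀)
stuck-ctx-step E₀ (vapp v p E) s = appR-E p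
  (subst (λ X → Step _ (plugE E (sft s)) (rst (sub0 s (cont X))))
         (compE-assoc E₀ (vapp v p hole) E) (stuck-ctx-step (compE E₀ (vapp v p hole)) E s))
stuck-ctx-step E₀ (appl E u) s = appL-E
  (subst (λ X → Step _ (plugE E (sft s)) (rst (sub0 s (cont X))))
         (compE-assoc E₀ (appl hole u) E) (stuck-ctx-step (compE E₀ (appl hole u)) E s))

ctx-step-inversion : ∀ {E₀ t t'} → Step (ctx E₀) t t' →
  ∃[ E ] ∃[ s ] ((t ≡ plugE E (sft s)) × (t' ≡ rst (sub0 s (cont (compE E₀ E)))))
ctx-step-inversion {E₀} (sft-E {t} .E₀) =
  hole , t , refl , cong (λ X → rst (sub0 t (cont X))) (sym (compE-identityʳ E₀))
ctx-step-inversion {E₀} (appL-E {t₁ = u} st) with ctx-step-inversion st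
... | E , s , refl , refl =
  appl E u , s , refl , cong (λ X → rst (sub0 s (cont X))) (compE-assoc E₀ (appl hole u) E)
ctx-step-inversion {E₀} (appR-E {v = v} p st) with ctx-step-inversion st
... | E , s , refl , refl =
  vapp v p E , s , refl , cong (λ X → rst (sub0 s (cont X))) (compE-assoc E₀ (vapp v p hole) E)

plugF-τ : (F : ECtx 0) {a b : Tm 0} → Step τ a b → Step τ (plugF F a) (plugF F b)
plugF-τ hole         s = s
plugF-τ (vapp v p F) s = appR-τ p (plugF-τ F s)
plugF-τ (appl F u)   s = appL-τ (plugF-τ F s)
plugF-τ (rst F)      s = rst-τ (plugF-τ F s)

⟶⇒τ : {a b : Tm 0} → a ⟶ b → Step τ a b
⟶⇒τ (β-red F p)     = plugF-τ F (β p)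
⟶⇒τ (sft-red F E t) = plugF-τ F (rst-□ (stuck-ctx-step hole E t))
⟶⇒τ (rst-red F p)   = plugF-τ F (rst-v p)

τ⇒⟶ : {a b : Tm 0} → Step τ a b → a ⟶ b
τ⇒⟶ (β p)               = β-red hole p
τ⇒⟶ (appL-τ {t₁ = u} s) = plugF-⟶ (appl hole u) (τ⇒⟶ s)
τ⇒⟶ (appR-τ p s)        = plugF-⟶ (vapp _ p hole) (τ⇒⟶ s)
τ⇒⟶ (rst-v p)           = rst-red hole p
τ⇒⟶ (rst-τ s)           = plugF-⟶ (rst hole) (τ⇒⟶ s)
τ⇒⟶ (rst-□ s) with ctx-step-inversion s
... | E , s' , refl , refl = sft-red hole E s'

⟶*⇒τ : {a b : Tm 0} → a ⟶* b → a ⇒τ b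
⟶*⇒τ ε       = ε
⟶*⇒τ (r ◅ q) = ⟶⇒τ r ◅ ⟶*⇒τ q

⇒τ⇒⟶* : {a b : Tm 0} → a ⇒τ b → a ⟶* b
⇒τ⇒⟶* ε       = ε
⇒τ⇒⟶* (s ◅ q) = τ⇒⟶ s ◅ ⇒τ⇒⟶* q

⟶-deterministic : {a b c : Tm 0} → a ⟶ b → a ⟶ c → b ≡ c
⟶-deterministic r r' = τ-deterministic (⟶⇒τ r) (⟶⇒τ r')

stuck-not-value : ∀ {n} (E : PCtx n) s → ¬ Value (plugE E (sft s))
stuck-not-value hole         s ()
stuck-not-value (vapp v p E) s ()
stuck-not-value (appl E u)   s ()

stuck-normal : ∀ (E : PCtx 0) s → NormalForm (plugE E (sft s))
stuck-normal E s =
  inj₂ (stuck-not-value E s , λ _ r → ctx-τ-exclusive (stuck-ctx-step hole E s) (⟶⇒τ r))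

appL-⇒τ : ∀ {a b u} → a ⇒τ b → app a u ⇒τ app b u
appL-⇒τ ε       = ε
appL-⇒τ (s ◅ q) = appL-τ s ◅ appL-⇒τ q

appR-⇒τ : ∀ {v a b} → Value v → a ⇒τ b → app v a ⇒τ app v b
appR-⇒τ p ε       = ε
appR-⇒τ p (s ◅ q) = appR-τ p s ◅ appR-⇒τ p q

rst-⇒τ : ∀ {a b} → a ⇒τ b → rst a ⇒τ rst b
rst-⇒τ ε       = ε
rst-⇒τ (s ◅ q) = rst-τ s ◅ rst-⇒τ q

-- Simulation and similarity

VisibleStep : Label → Tm 0 → Tm 0 → Set
VisibleStep α t t'' = ∃[ t' ] (t ⇒τ t' × Step α t' t'')

step⇒weak : ∀ {α a b} → Step α a b → WeakStep α a b
step⇒weak {τ}       s = s ◅ ε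
step⇒weak {val _ _} s = _ , ε , s
step⇒weak {ctx _}   s = _ , ε , s

⇒τ-weak : ∀ {α a b c} → a ⇒τ b → WeakStep α b c → WeakStep α a c
⇒τ-weak {τ}       q w            = q ◅◅ w
⇒τ-weak {val _ _} q (d , q' , s) = d , q ◅◅ q' , s
⇒τ-weak {ctx _}   q (d , q' , s) = d , q ◅◅ q' , s

-- By determinism, any τ-reduct of the start of a visible weak step lies on it.
⇒τ-visible : ∀ {α a b c} → α ≢ τ → a ⇒τ b → VisibleStep α a c → VisibleStep α b c
⇒τ-visible α≢τ q (d , q' , s) with ⇒τ-comparable q q'
... | inj₁ b⇒d = d , b⇒d , s
... | inj₂ (s' ◅ _) = ⊥-elim (visible-no-τ α≢τ s s')
... | inj₂ ε = d , ε , s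

IsSimulationℓ : ∀ {ℓ} → (Tm 0 → Tm 0 → Set ℓ) → Set ℓ
IsSimulationℓ R = ∀ {t₀ t₁} → R t₀ t₁ → ∀ α t₀' → Step α t₀ t₀' →
  ∃[ t₁' ] (WeakStep α t₁ t₁' × R t₀' t₁')

module _ {ℓ} {R : Tm 0 → Tm 0 → Set ℓ} (sim : IsSimulationℓ R) where

  ⇒τ-simulation : ∀ {x y x'} → R x y → x ⇒τ x' → ∃[ y' ] (y ⇒τ y' × R x' y')
  ⇒τ-simulation r ε = _ , ε , r
  ⇒τ-simulation r (s ◅ q) with sim r τ _ s
  ... | _ , w , r₁ with ⇒τ-simulation r₁ q
  ... | y₂ , w' , r₂ = y₂ , w ◅◅ w' , r₂

  visible-simulation : ∀ {α x y x'} → R x y → VisibleStep α x x' →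
    ∃[ y' ] (WeakStep α y y' × R x' y')
  visible-simulation r (_ , q , s) with ⇒τ-simulation r q
  ... | _ , w , r₁ with sim r₁ _ _ s
  ... | y₂ , w' , r₂ = y₂ , ⇒τ-weak w w' , r₂

  weak-simulation : ∀ {α x y x'} → R x y → WeakStep α x x' →
    ∃[ y' ] (WeakStep α y y' × R x' y')
  weak-simulation {τ}       = ⇒τ-simulation
  weak-simulation {val _ _} = visible-simulation
  weak-simulation {ctx _}   = visible-simulation

  -- A λ answers every value label; only a λ does.
  simulation-lam : ∀ {s t} → R (lam s) t → ∃[ s' ] (t ⇒τ lam s')
  simulation-lam {s} r with sim r (val (lam s) (vlam s)) _ (lam-v (vlam s))
  ... | _ , (_ , q , lam-v _) , _ = _ , q

  simulation-value : ∀ {t₀ t₁} → R t₀ t₁ → EvalsToValue t₀ → EvalsToValue t₁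
  simulation-value r (w , (red , _) , vw) with closed-value-lam vw
  ... | _ , refl with ⇒τ-simulation r (⟶*⇒τ red)
  ... | _ , q , r' with simulation-lam r'
  ... | _ , q' = _ , (⇒τ⇒⟶* (q ◅◅ q') , inj₁ (vlam _)) , vlam _

  simulation-stuck : ∀ {t₀ t₁} → R t₀ t₁ → EvalsToStuck t₀ → EvalsToStuck t₁
  simulation-stuck r (_ , (red , _) , (E , s , refl)) with ⇒τ-simulation r (⟶*⇒τ red)
  ... | _ , q , r' with sim r' (ctx hole) _ (stuck-ctx-step hole E s)
  ... | _ , (_ , q' , st) , _ with ctx-step-inversion st
  ... | E₂ , s₂ , refl , _ =
    _ , (⇒τ⇒⟶* (q ◅◅ q') , stuck-normal E₂ s₂) , (E₂ , s₂ , refl)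

_≲_ : Tm 0 → Tm 0 → Set₁
t₀ ≲ t₁ = Σ Rel₀ λ R → IsSimulation R × R t₀ t₁

≲-simulation : IsSimulationℓ _≲_
≲-simulation (R , sim , r) α t₀' st with sim r α t₀' st
... | t₁' , w , r' = t₁' , w , (R , sim , r')

≲-refl : ∀ t → t ≲ t
≲-refl t = _≡_ , (λ { refl α t' st → t' , step⇒weak st , refl }) , refl

≲-trans : ∀ {a b c} → a ≲ b → b ≲ c → a ≲ c
≲-trans {b = b} (R , simR , r) (S , simS , s) = R⨾S , sim , (b , r , s)
  where
  R⨾S : Rel₀
  R⨾S x z = ∃[ y ] (R x y × S y z)
  sim : IsSimulation R⨾S
  sim (y , r₁ , s₁) α x' st with simR r₁ α x' st
  ... | y' , w , r' with weak-simulation simS s₁ w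
  ... | z' , w' , s' = z' , w' , (y' , r' , s')

≲-⇒τʳ : ∀ {x y y'} → x ≲ y → y ⇒τ y' → x ≲ y'
≲-⇒τʳ {y = y} (R , simR , r) q = R⨾⇒τ , sim , (y , r , q)
  where
  R⨾⇒τ : Rel₀
  R⨾⇒τ a b = ∃[ c ] (R a c × c ⇒τ b)
  sim : IsSimulation R⨾⇒τ
  sim (c , r₁ , q₁) τ a' st with simR r₁ τ a' st
  ... | c' , w , r' with ⇒τ-comparable q₁ w
  ... | inj₁ b⇒c' = c' , b⇒c' , (c' , r' , ε)
  ... | inj₂ c'⇒b = _ , ε , (c' , r' , c'⇒b)
  sim (c , r₁ , q₁) α@(val _ _) a' st with simR r₁ α a' st
  ... | c' , w , r' = c' , ⇒τ-visible (λ ()) q₁ w , (c' , r' , ε)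
  sim (c , r₁ , q₁) α@(ctx _) a' st with simR r₁ α a' st
  ... | c' , w , r' = c' , ⇒τ-visible (λ ()) q₁ w , (c' , r' , ε)

≈⇒≲ : ∀ {t₀ t₁} → t₀ ≈ t₁ → t₀ ≲ t₁
≈⇒≲ (R , (sim , _) , r) = R , sim , r

≈⇒≳ : ∀ {t₀ t₁} → t₀ ≈ t₁ → t₁ ≲ t₀
≈⇒≳ (R , (_ , sim⁻¹) , r) = (λ a b → R b a) , sim⁻¹ , r

record _≲ᵒ_ {n} (s t : Tm n) : Set₁ where
  constructor mk≲ᵒ
  field close : (σ : Sub n 0) → ValueSub σ → sub σ s ≲ sub σ t
open _≲ᵒ_

≲ᵒ-refl : ∀ {n} (t : Tm n) → t ≲ᵒ t
≲ᵒ-refl t = mk≲ᵒ λ σ _ → ≲-refl _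

≲ᵒ-trans : ∀ {n} {a b c : Tm n} → a ≲ᵒ b → b ≲ᵒ c → a ≲ᵒ c
≲ᵒ-trans p q = mk≲ᵒ λ σ vσ → ≲-trans (close p σ vσ) (close q σ vσ)

≲ᵒ-sub : ∀ {n m} (σ : Sub n m) → ValueSub σ → ∀ {s t} → s ≲ᵒ t → sub σ s ≲ᵒ sub σ t
≲ᵒ-sub σ vσ {s} {t} p = mk≲ᵒ λ σ₀ vσ₀ →
  subst₂ _≲_ (sym (sub-sub (λ _ → refl) s)) (sym (sub-sub (λ _ → refl) t))
    (close p (λ i → sub σ₀ (σ i)) (λ i → sub-value vσ₀ (vσ i)))

≲ᵒ-ren : ∀ {n m} (ρ : Ren n m) → ∀ {s t} → s ≲ᵒ t → ren ρ s ≲ᵒ ren ρ t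
≲ᵒ-ren ρ {s} {t} p =
  subst₂ _≲ᵒ_ (sym (ren-as-sub (λ _ → refl) s)) (sym (ren-as-sub (λ _ → refl) t))
    (≲ᵒ-sub (λ i → var (ρ i)) (λ i → vvar _) p)

≲ᵒ⇒≲ : ∀ {s t : Tm 0} → s ≲ᵒ t → s ≲ t
≲ᵒ⇒≲ {s} {t} p = subst₂ _≲_ (sub-closed _ s) (sub-closed _ t) (close p (λ ()) (λ ()))

≲⇒≲ᵒ : ∀ {s t : Tm 0} → s ≲ t → s ≲ᵒ t
≲⇒≲ᵒ {s} {t} p = mk≲ᵒ λ σ _ → subst₂ _≲_ (sym (sub-closed σ s)) (sym (sub-closed σ t)) p

-- The Howe closure

data _≲ᴴ_ : ∀ {n} → Tm n → Tm n → Set₁ where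
  hvar : ∀ {n} {x : Fin n} {t} → var x ≲ᵒ t → var x ≲ᴴ t
  hlam : ∀ {n} {s s' : Tm (suc n)} {t} → s ≲ᴴ s' → lam s' ≲ᵒ t → lam s ≲ᴴ t
  happ : ∀ {n} {a b a' b' t : Tm n} → a ≲ᴴ a' → b ≲ᴴ b' → app a' b' ≲ᵒ t → app a b ≲ᴴ t
  hsft : ∀ {n} {s s' : Tm (suc n)} {t} → s ≲ᴴ s' → sft s' ≲ᵒ t → sft s ≲ᴴ t
  hrst : ∀ {n} {a a' t : Tm n} → a ≲ᴴ a' → rst a' ≲ᵒ t → rst a ≲ᴴ t

≲ᴴ-≲ᵒ-trans : ∀ {n} {s t u : Tm n} → s ≲ᴴ t → t ≲ᵒ u → s ≲ᴴ u
≲ᴴ-≲ᵒ-trans (hvar p)       q = hvar (≲ᵒ-trans p q)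
≲ᴴ-≲ᵒ-trans (hlam h p)     q = hlam h (≲ᵒ-trans p q)
≲ᴴ-≲ᵒ-trans (happ h₁ h₂ p) q = happ h₁ h₂ (≲ᵒ-trans p q)
≲ᴴ-≲ᵒ-trans (hsft h p)     q = hsft h (≲ᵒ-trans p q)
≲ᴴ-≲ᵒ-trans (hrst h p)     q = hrst h (≲ᵒ-trans p q)

≲ᴴ-≲-trans : ∀ {s t u : Tm 0} → s ≲ᴴ t → t ≲ u → s ≲ᴴ u
≲ᴴ-≲-trans h p = ≲ᴴ-≲ᵒ-trans h (≲⇒≲ᵒ p)

≲ᴴ-refl : ∀ {n} (t : Tm n) → t ≲ᴴ t
≲ᴴ-refl (var x)   = hvar (≲ᵒ-refl _)
≲ᴴ-refl (lam t)   = hlam (≲ᴴ-refl t) (≲ᵒ-refl _)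
≲ᴴ-refl (app t u) = happ (≲ᴴ-refl t) (≲ᴴ-refl u) (≲ᵒ-refl _)
≲ᴴ-refl (sft t)   = hsft (≲ᴴ-refl t) (≲ᵒ-refl _)
≲ᴴ-refl (rst t)   = hrst (≲ᴴ-refl t) (≲ᵒ-refl _)

≲ᵒ⇒≲ᴴ : ∀ {n} {s t : Tm n} → s ≲ᵒ t → s ≲ᴴ t
≲ᵒ⇒≲ᴴ {s = s} = ≲ᴴ-≲ᵒ-trans (≲ᴴ-refl s)

≲ᴴ-lam : ∀ {n} {s s' : Tm (suc n)} → s ≲ᴴ s' → lam s ≲ᴴ lam s'
≲ᴴ-lam h = hlam h (≲ᵒ-refl _)

≲ᴴ-app : ∀ {n} {a b a' b' : Tm n} → a ≲ᴴ a' → b ≲ᴴ b' → app a b ≲ᴴ app a' b'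
≲ᴴ-app h₁ h₂ = happ h₁ h₂ (≲ᵒ-refl _)

≲ᴴ-sft : ∀ {n} {s s' : Tm (suc n)} → s ≲ᴴ s' → sft s ≲ᴴ sft s'
≲ᴴ-sft h = hsft h (≲ᵒ-refl _)

≲ᴴ-rst : ∀ {n} {a a' : Tm n} → a ≲ᴴ a' → rst a ≲ᴴ rst a'
≲ᴴ-rst h = hrst h (≲ᵒ-refl _)

≲ᴴ-ren : ∀ {n m} (ρ : Ren n m) {s t : Tm n} → s ≲ᴴ t → ren ρ s ≲ᴴ ren ρ t
≲ᴴ-ren ρ (hvar p)       = hvar (≲ᵒ-ren ρ p)
≲ᴴ-ren ρ (hlam h p)     = hlam (≲ᴴ-ren (extR ρ) h) (≲ᵒ-ren ρ p)
≲ᴴ-ren ρ (happ h₁ h₂ p) = happ (≲ᴴ-ren ρ h₁) (≲ᴴ-ren ρ h₂) (≲ᵒ-ren ρ p)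
≲ᴴ-ren ρ (hsft h p)     = hsft (≲ᴴ-ren (extR ρ) h) (≲ᵒ-ren ρ p)
≲ᴴ-ren ρ (hrst h p)     = hrst (≲ᴴ-ren ρ h) (≲ᵒ-ren ρ p)

_≲ᴴˢ_ : ∀ {n m} → Sub n m → Sub n m → Set₁
σ ≲ᴴˢ σ' = ∀ i → σ i ≲ᴴ σ' i

extS-≲ᴴˢ : ∀ {n m} {σ σ' : Sub n m} → σ ≲ᴴˢ σ' → extS σ ≲ᴴˢ extS σ'
extS-≲ᴴˢ h zero    = ≲ᴴ-refl _
extS-≲ᴴˢ h (suc i) = ≲ᴴ-ren suc (h i)

≲ᴴ-sub : ∀ {n m} {σ σ' : Sub n m} → ValueSub σ' → σ ≲ᴴˢ σ' →
  ∀ {s t} → s ≲ᴴ t → sub σ s ≲ᴴ sub σ' t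
≲ᴴ-sub {σ' = σ'} vσ' hσ (hvar {x = x} p) = ≲ᴴ-≲ᵒ-trans (hσ x) (≲ᵒ-sub σ' vσ' p)
≲ᴴ-sub {σ' = σ'} vσ' hσ (hlam h p) =
  hlam (≲ᴴ-sub (extS-value vσ') (extS-≲ᴴˢ hσ) h) (≲ᵒ-sub σ' vσ' p)
≲ᴴ-sub {σ' = σ'} vσ' hσ (happ h₁ h₂ p) =
  happ (≲ᴴ-sub vσ' hσ h₁) (≲ᴴ-sub vσ' hσ h₂) (≲ᵒ-sub σ' vσ' p)
≲ᴴ-sub {σ' = σ'} vσ' hσ (hsft h p) =
  hsft (≲ᴴ-sub (extS-value vσ') (extS-≲ᴴˢ hσ) h) (≲ᵒ-sub σ' vσ' p)
≲ᴴ-sub {σ' = σ'} vσ' hσ (hrst h p) = hrst (≲ᴴ-sub vσ' hσ h) (≲ᵒ-sub σ' vσ' p)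

≲ᴴ-sub0 : ∀ {n} {s s' : Tm (suc n)} {v v' : Tm n} → Value v' →
  s ≲ᴴ s' → v ≲ᴴ v' → sub0 s v ≲ᴴ sub0 s' v'
≲ᴴ-sub0 {s = s} {s'} {v} {v'} pv' h hv =
  subst₂ _≲ᴴ_ (sym (sub0-single s v)) (sym (sub0-single s' v'))
    (≲ᴴ-sub (single-value pv') single-≲ᴴˢ h)
  where
  single-≲ᴴˢ : single v ≲ᴴˢ single v'
  single-≲ᴴˢ zero    = hv
  single-≲ᴴˢ (suc i) = ≲ᴴ-refl _

data _≲ᴴᴱ_ {n} : PCtx n → PCtx n → Set₁ where
  hhole : hole ≲ᴴᴱ hole
  hvapp : ∀ {v v' p p' E E'} → v ≲ᴴ v' → E ≲ᴴᴱ E' → vapp v p E ≲ᴴᴱ vapp v' p' E'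
  happl : ∀ {E E' u u'} → E ≲ᴴᴱ E' → u ≲ᴴ u' → appl E u ≲ᴴᴱ appl E' u'

≲ᴴᴱ-refl : ∀ {n} (E : PCtx n) → E ≲ᴴᴱ E
≲ᴴᴱ-refl hole         = hhole
≲ᴴᴱ-refl (vapp v _ E) = hvapp (≲ᴴ-refl v) (≲ᴴᴱ-refl E)
≲ᴴᴱ-refl (appl E u)   = happl (≲ᴴᴱ-refl E) (≲ᴴ-refl u)

≲ᴴᴱ-compE : ∀ {n} {E₁ E₁' E₂ E₂' : PCtx n} →
  E₁ ≲ᴴᴱ E₁' → E₂ ≲ᴴᴱ E₂' → compE E₁ E₂ ≲ᴴᴱ compE E₁' E₂'
≲ᴴᴱ-compE hhole         h = h
≲ᴴᴱ-compE (hvapp hv hE) h = hvapp hv (≲ᴴᴱ-compE hE h)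
≲ᴴᴱ-compE (happl hE hu) h = happl (≲ᴴᴱ-compE hE h) hu

≲ᴴᴱ-renE : ∀ {n m} (ρ : Ren n m) {E E'} → E ≲ᴴᴱ E' → renE ρ E ≲ᴴᴱ renE ρ E'
≲ᴴᴱ-renE ρ hhole         = hhole
≲ᴴᴱ-renE ρ (hvapp hv hE) = hvapp (≲ᴴ-ren ρ hv) (≲ᴴᴱ-renE ρ hE)
≲ᴴᴱ-renE ρ (happl hE hu) = happl (≲ᴴᴱ-renE ρ hE) (≲ᴴ-ren ρ hu)

≲ᴴ-plugE : ∀ {n} {E E' : PCtx n} {s s'} → E ≲ᴴᴱ E' → s ≲ᴴ s' → plugE E s ≲ᴴ plugE E' s'
≲ᴴ-plugE hhole         h = h
≲ᴴ-plugE (hvapp hv hE) h = ≲ᴴ-app hv (≲ᴴ-plugE hE h)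
≲ᴴ-plugE (happl hE hu) h = ≲ᴴ-app (≲ᴴ-plugE hE h) hu

≲ᴴ-cont : ∀ {n} {E E' : PCtx n} → E ≲ᴴᴱ E' → cont E ≲ᴴ cont E'
≲ᴴ-cont h = ≲ᴴ-lam (≲ᴴ-rst (≲ᴴ-plugE (≲ᴴᴱ-renE suc h) (≲ᴴ-refl _)))

≲ᴴ-plugC : ∀ {n} (C : Ctx n) {t₀ t₁} → t₀ ≲ t₁ → plugC C t₀ ≲ᴴ plugC C t₁
≲ᴴ-plugC hole       p = ≲ᴴ-ren (λ ()) (≲ᵒ⇒≲ᴴ (≲⇒≲ᵒ p))
≲ᴴ-plugC (lam C)    p = ≲ᴴ-lam (≲ᴴ-plugC C p)
≲ᴴ-plugC (appr u C) p = ≲ᴴ-app (≲ᴴ-refl u) (≲ᴴ-plugC C p)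
≲ᴴ-plugC (appl C u) p = ≲ᴴ-app (≲ᴴ-plugC C p) (≲ᴴ-refl u)
≲ᴴ-plugC (sft C)    p = ≲ᴴ-sft (≲ᴴ-plugC C p)
≲ᴴ-plugC (rst C)    p = ≲ᴴ-rst (≲ᴴ-plugC C p)

≲ᴴ-lam-reaches-lam : ∀ {s : Tm 1} {t} → lam s ≲ᴴ t →
  ∃[ s' ] (t ⇒τ lam s' × lam s ≲ᴴ lam s')
≲ᴴ-lam-reaches-lam (hlam h p) with simulation-lam ≲-simulation (≲ᵒ⇒≲ p)
... | _ , q = _ , q , hlam h (≲⇒≲ᵒ (≲-⇒τʳ (≲ᵒ⇒≲ p) q))

-- Closes every case below: the trailing ≲ᵒ of a ≲ᴴ-derivation is crossed by ≲.
≲ᴴ-by-≲ᵒ : ∀ {α X X' t₁ t₀'} → X ≲ᵒ t₁ → WeakStep α X X' → t₀' ≲ᴴ X' →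
  ∃[ t₁' ] (WeakStep α t₁ t₁' × t₀' ≲ᴴ t₁')
≲ᴴ-by-≲ᵒ p w h with weak-simulation ≲-simulation (≲ᵒ⇒≲ p) w
... | t₁' , w' , p' = t₁' , w' , ≲ᴴ-≲-trans h p'

≲ᴴ-val-step : ∀ {s : Tm 1} {t₁ v v'} (pv' : Value v') → lam s ≲ᴴ t₁ → v ≲ᴴ v' →
  ∃[ t₁' ] (WeakStep (val v' pv') t₁ t₁' × sub0 s v ≲ᴴ t₁')
≲ᴴ-val-step pv' (hlam h p) hv =
  ≲ᴴ-by-≲ᵒ {α = val _ pv'} p (_ , ε , lam-v pv') (≲ᴴ-sub0 pv' h hv)

-- The label is generalised to a ≲ᴴᴱ-related pair: the application cases
-- extend it with the two related function or argument terms.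
≲ᴴ-ctx-step : ∀ {E E' t₀ t₀' t₁} → Step (ctx E) t₀ t₀' → t₀ ≲ᴴ t₁ → E ≲ᴴᴱ E' →
  ∃[ t₁' ] (WeakStep (ctx E') t₁ t₁' × t₀' ≲ᴴ t₁')
≲ᴴ-ctx-step (sft-E E) (hsft h p) hE =
  ≲ᴴ-by-≲ᵒ {α = ctx _} p (_ , ε , sft-E _) (≲ᴴ-rst (≲ᴴ-sub0 (vlam _) h (≲ᴴ-cont hE)))
≲ᴴ-ctx-step (appL-E st) (happ ha hb p) hE
  with ≲ᴴ-ctx-step st ha (≲ᴴᴱ-compE hE (happl hhole hb))
... | _ , (_ , q , s) , h = ≲ᴴ-by-≲ᵒ {α = ctx _} p (_ , appL-⇒τ q , appL-E s) h
≲ᴴ-ctx-step (appR-E pv st) (happ ha hb p) hE with closed-value-lam pv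
... | _ , refl with ≲ᴴ-lam-reaches-lam ha
... | s' , qa , hv with ≲ᴴ-ctx-step st hb (≲ᴴᴱ-compE hE (hvapp {p' = vlam s'} hv hhole))
... | _ , (_ , qb , s) , h =
  ≲ᴴ-by-≲ᵒ {α = ctx _} p (_ , appL-⇒τ qa ◅◅ appR-⇒τ (vlam s') qb , appR-E (vlam s') s) h

≲ᴴ-τ-step : ∀ {t₀ t₀' t₁} → Step τ t₀ t₀' → t₀ ≲ᴴ t₁ → ∃[ t₁' ] (t₁ ⇒τ t₁' × t₀' ≲ᴴ t₁')
≲ᴴ-τ-step (β pv) (happ ha hb p) with closed-value-lam pv
... | _ , refl with ≲ᴴ-lam-reaches-lam hb
... | r , qb , hv with ≲ᴴ-val-step (vlam r) ha hv
... | _ , (_ , qa , lam-v _) , h =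
  ≲ᴴ-by-≲ᵒ {α = τ} p (appL-⇒τ qa ◅◅ appR-⇒τ (vlam _) qb ◅◅ (β (vlam r) ◅ ε)) h
≲ᴴ-τ-step (appL-τ st) (happ ha hb p) with ≲ᴴ-τ-step st ha
... | _ , q , h = ≲ᴴ-by-≲ᵒ {α = τ} p (appL-⇒τ q) (≲ᴴ-app h hb)
≲ᴴ-τ-step (appR-τ pv st) (happ ha hb p) with closed-value-lam pv
... | _ , refl with ≲ᴴ-lam-reaches-lam ha
... | s' , qa , hv with ≲ᴴ-τ-step st hb
... | _ , qb , h = ≲ᴴ-by-≲ᵒ {α = τ} p (appL-⇒τ qa ◅◅ appR-⇒τ (vlam s') qb) (≲ᴴ-app hv h)
≲ᴴ-τ-step (rst-v pv) (hrst ha p) with closed-value-lam pv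
... | _ , refl with ≲ᴴ-lam-reaches-lam ha
... | s' , qa , hv = ≲ᴴ-by-≲ᵒ {α = τ} p (rst-⇒τ qa ◅◅ (rst-v (vlam s') ◅ ε)) hv
≲ᴴ-τ-step (rst-τ st) (hrst ha p) with ≲ᴴ-τ-step st ha
... | _ , q , h = ≲ᴴ-by-≲ᵒ {α = τ} p (rst-⇒τ q) (≲ᴴ-rst h)
≲ᴴ-τ-step (rst-□ st) (hrst ha p) with ≲ᴴ-ctx-step st ha hhole
... | _ , (_ , q , s) , h = ≲ᴴ-by-≲ᵒ {α = τ} p (rst-⇒τ q ◅◅ (rst-□ s ◅ ε)) h

≲ᴴ-simulation : IsSimulationℓ (_≲ᴴ_ {0})
≲ᴴ-simulation h τ         _ st          = ≲ᴴ-τ-step st h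
≲ᴴ-simulation h (val v pv) _ (lam-v .pv) = ≲ᴴ-val-step pv h (≲ᴴ-refl v)
≲ᴴ-simulation h (ctx E)   _ st          = ≲ᴴ-ctx-step st h (≲ᴴᴱ-refl E)

-- Observational equivalence

_≃_ : Tm 0 → Tm 0 → Set
a ≃ b = (EvalsToValue a ⇔ EvalsToValue b) × (EvalsToStuck a ⇔ EvalsToStuck b)

module ⇔ = IsEquivalence (⇔-isEquivalence {ℓ = 0ℓ})

≃-isEquivalence : IsEquivalence _≃_
≃-isEquivalence = record
  { refl  = ⇔.refl , ⇔.refl
  ; sym   = λ (p , q) → ⇔.sym p , ⇔.sym q
  ; trans = λ (p , q) (p' , q') → ⇔.trans p p' , ⇔.trans q q'
  }

≃-setoid : Setoid 0ℓ 0ℓ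
≃-setoid = record { isEquivalence = ≃-isEquivalence }

open IsEquivalence ≃-isEquivalence using () renaming (refl to ≃-refl; sym to ≃-sym; trans to ≃-trans)

simulation-≃ : ∀ {ℓ} {R : Tm 0 → Tm 0 → Set ℓ} → IsSimulationℓ R →
  ∀ {t₀ t₁} → R t₀ t₁ → R t₁ t₀ → t₀ ≃ t₁
simulation-≃ sim r r' =
  mk⇔ (simulation-value sim r) (simulation-value sim r') ,
  mk⇔ (simulation-stuck sim r) (simulation-stuck sim r')

⟶-normal-form : ∀ {a b w : Tm 0} → a ⟶ b → a ⟶* w → NormalForm w → b ⟶* w
⟶-normal-form r ε (inj₁ v)        = ⊥-elim (value-no-τ v (⟶⇒τ r))
⟶-normal-form r ε (inj₂ (_ , nr)) = ⊥-elim (nr _ r)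
⟶-normal-form r (r' ◅ q) _ with ⟶-deterministic r r'
... | refl = q

⟶-≃ : ∀ {a b : Tm 0} → a ⟶ b → a ≃ b
⟶-≃ {a} {b} r = mk⇔ forward backward , mk⇔ forward backward
  where
  forward : ∀ {P : Tm 0 → Set} → ∃[ w ] (a ⇓ w × P w) → ∃[ w ] (b ⇓ w × P w)
  forward (w , (q , nf) , pw) = w , (⟶-normal-form r q nf , nf) , pw
  backward : ∀ {P : Tm 0 → Set} → ∃[ w ] (b ⇓ w × P w) → ∃[ w ] (a ⇓ w × P w)
  backward (w , (q , nf) , pw) = w , (r ◅ q , nf) , pw

⟶*-≃ : ∀ {a b : Tm 0} → a ⟶* b → a ≃ b
⟶*-≃ ε       = ≃-refl
⟶*-≃ (r ◅ q) = ≃-trans (⟶-≃ r) (⟶*-≃ q)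

≈⇒≅ : ∀ {t₀ t₁} → t₀ ≈ t₁ → t₀ ≅ t₁
≈⇒≅ b C = simulation-≃ ≲ᴴ-simulation (≲ᴴ-plugC C (≈⇒≲ b)) (≲ᴴ-plugC C (≈⇒≳ b))

≅⇒≅F : ∀ {t₀ t₁} → t₀ ≅ t₁ → t₀ ≅F t₁
≅⇒≅F {t₀} {t₁} h F = subst₂ _≃_ (plugC-toCtx F t₀) (plugC-toCtx F t₁) (h (toCtx F))

≅F-simulation : IsSimulation _≅F_
≅F-simulation h τ _ st = _ , ε , λ F → ≃-trans (≃-sym (⟶-≃ (plugF-⟶ F (τ⇒⟶ st)))) (h F)
≅F-simulation {lam s} {t₁} h (val v pv) _ (lam-v .pv)
  with Equivalence.to (proj₁ (h hole)) (lam s , (ε , inj₁ (vlam s)) , vlam s)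
... | w , (red , _) , vw with closed-value-lam vw
... | s' , refl = sub0 s' v , (lam s' , ⟶*⇒τ red , lam-v pv) , λ F → begin
  plugF F (sub0 s v)                      ≈⟨ ⟶-≃ (β-red F pv) ⟨
  plugF F (app (lam s) v)                 ≡⟨ plugF-compF F □v (lam s) ⟨
  plugF (compF F □v) (lam s)              ≈⟨ h (compF F □v) ⟩
  plugF (compF F □v) t₁                   ≈⟨ ⟶*-≃ (plugF-⟶* (compF F □v) red) ⟩
  plugF (compF F □v) (lam s')             ≡⟨ plugF-compF F □v (lam s') ⟩
  plugF F (app (lam s') v)                ≈⟨ ⟶-≃ (β-red F pv) ⟩
  plugF F (sub0 s' v)                     ∎
  where
  open SetoidReasoning ≃-setoid
  □v : ECtx 0
  □v = appl hole v
≅F-simulation {t₁ = t₁} h (ctx E) _ st with ctx-step-inversion st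
... | E₁ , s , refl , refl
  with Equivalence.to (proj₂ (h hole)) (_ , (ε , stuck-normal E₁ s) , (E₁ , s , refl))
... | _ , (red , _) , (E₂ , s₂ , refl) =
  _ , (_ , ⟶*⇒τ red , stuck-ctx-step E E₂ s₂) , λ F → begin
  plugF F (rst (sub0 s (cont (compE E E₁))))   ≈⟨ ⟶-≃ (sft-red F (compE E E₁) s) ⟨
  plugF F (rst (plugE (compE E E₁) (sft s)))   ≡⟨ plugF-⟨E⟩ F E₁ s ⟨
  plugF (compF F ⟨E⟩) (plugE E₁ (sft s))       ≈⟨ h (compF F ⟨E⟩) ⟩
  plugF (compF F ⟨E⟩) t₁                       ≈⟨ ⟶*-≃ (plugF-⟶* (compF F ⟨E⟩) red) ⟩
  plugF (compF F ⟨E⟩) (plugE E₂ (sft s₂))      ≡⟨ plugF-⟨E⟩ F E₂ s₂ ⟩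
  plugF F (rst (plugE (compE E E₂) (sft s₂)))  ≈⟨ ⟶-≃ (sft-red F (compE E E₂) s₂) ⟩
  plugF F (rst (sub0 s₂ (cont (compE E E₂))))  ∎
  where
  open SetoidReasoning ≃-setoid
  ⟨E⟩ : ECtx 0
  ⟨E⟩ = rst (pureToECtx E)
  plugF-⟨E⟩ : ∀ F E' s' →
    plugF (compF F ⟨E⟩) (plugE E' (sft s')) ≡ plugF F (rst (plugE (compE E E') (sft s')))
  plugF-⟨E⟩ F E' s' = trans (plugF-compF F ⟨E⟩ _)
    (cong (λ X → plugF F (rst X))
      (trans (plugF-pureToECtx E _) (sym (plugE-compE E E' (sft s')))))

≅F⇒≈ : ∀ {t₀ t₁} → t₀ ≅F t₁ → t₀ ≈ t₁
≅F⇒≈ h = _≅F_ , (≅F-simulation , ≅F-simulation⁻¹) , h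
  where
  ≅F-sym : ∀ {a b} → a ≅F b → b ≅F a
  ≅F-sym p F = ≃-sym (p F)
  ≅F-simulation⁻¹ : IsSimulation (λ a b → b ≅F a)
  ≅F-simulation⁻¹ p α t st with ≅F-simulation (≅F-sym p) α t st
  ... | u , w , q = u , w , ≅F-sym q

corollary4p17 : (t₀ t₁ : Tm 0) →
    ((t₀ ≅ t₁) ⇔ (t₀ ≅F t₁)) × ((t₀ ≅F t₁) ⇔ (t₀ ≈ t₁))
corollary4p17 t₀ t₁ =
  mk⇔ ≅⇒≅F (λ h → ≈⇒≅ (≅F⇒≈ h)) ,
  mk⇔ ≅F⇒≈ (λ h → ≅⇒≅F (≈⇒≅ h))
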